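{- For all integers $m,j,k$, \[ F_{k+1}F_{m-2j-k+2}^2+F_{m+1}F_{m-k+1}=F_{2m-2j-2k+3}F_{2j+k-1}+F_kF_{m-2j-k+2}F_{m-2j-k+3}. \]
   Context: $F_p$ are the Fibonacci numbers, $F_0=0$, $F_1=1$, $F_{p+1}=F_p+F_{p-1}$, extended to all integers by the recurrence (so $F_{ -p}=(-1)^{p+1}F_p$). -}

module Defs where

open import Data.Nat using (ℕ; zero; suc)
import Data.Nat as ℕ
open import Data.Integer using (ℤ; +_; -[1+_]; -_)

fibℕ : ℕ → ℕ
fibℕ zero = 0
fibℕ (suc zero) = 1
fibℕ (suc (suc n)) = fibℕ (suc n) ℕ.+ fibℕ n

-- Fibonacci numbers extended to ℤ by the recurrence:
-- F (-p) = (-1)^(p+1) F p.  For -[1+ n ] = -(n+1): sign (-1)^(n+2) = (-1)^n.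
negSign : ℕ → ℤ → ℤ
negSign zero x = x
negSign (suc zero) x = - x
negSign (suc (suc n)) x = negSign n x

F : ℤ → ℤ
F (+ n) = + fibℕ n
F -[1+ n ] = negSign n (+ fibℕ (suc n))

-- Put b = m − 2j − k + 2 and c = 2j − 1; the long indices become k + b + c, b + c, 2b + c
-- and k + c. The addition formula F(x + c) = F(x + 1) F(c) + F(x) F(c − 1) expands a product
-- of two translates as
--   F(x + c) F(y + c) = F(x + y + 1) F(c)² + F(x + y) F(c) F(c − 1) + C(c) F(x) F(y)
-- with C(c) = F(c + 1) F(c − 1) − F(c)², so when x + y = z + w the difference
-- F(x + c) F(y + c) − F(z + c) F(w + c) is C(c) (F(x) F(y) − F(z) F(w)). By Cassini C(c) = −1
-- for odd c, and what remains, F(2b) F(k) − F(k + b) F(b) = F(b) (F(b + 1) F(k) − F(k + 1) F(b)),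
-- follows from the addition formula alone.
module Submission where

open import Defs
open import Data.Integer using (ℤ; _+_; _-_; _*_; +_; -[1+_]; -_)
open import Data.Integer.Properties
  using (+-comm; +-assoc; +-identityˡ; +-commutativeSemigroup; neg-involutive; neg-distrib-+)
open import Algebra.Properties.CommutativeSemigroup +-commutativeSemigroup using (xy∙z≈xz∙y)
open import Data.Integer.Tactic.RingSolver using (solve-∀)
open import Data.Nat using (zero; suc)
import Data.Nat.Properties as ℕ
open import Data.Product using (_×_; _,_; proj₁)
open import Relation.Binary.PropositionalEquality
  using (_≡_; refl; sym; trans; cong; cong₂; subst; module ≡-Reasoning)
open ≡-Reasoning

i+1+1≡i+2 : ∀ i → i + + 1 + + 1 ≡ i + + 2
i+1+1≡i+2 = solve-∀

i+1-1≡i : ∀ i → i + + 1 - + 1 ≡ i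
i+1-1≡i = solve-∀

i-1+1≡i : ∀ i → i - + 1 + + 1 ≡ i
i-1+1≡i = solve-∀

i-1+2≡i+1 : ∀ i → i - + 1 + + 2 ≡ i + + 1
i-1+2≡i+1 = solve-∀

ℤ-induction : (P : ℤ → Set) → P (+ 0) → (∀ n → P n → P (n + + 1)) →
              (∀ n → P n → P (n - + 1)) → ∀ n → P n
ℤ-induction P base up down (+ zero) = base
ℤ-induction P base up down (+ suc n) =
  subst P (cong +_ (ℕ.+-comm n 1)) (up (+ n) (ℤ-induction P base up down (+ n)))
ℤ-induction P base up down -[1+ zero ] = down (+ 0) base
ℤ-induction P base up down -[1+ suc n ] =
  subst P (cong (λ i → -[1+ suc i ]) (ℕ.+-identityʳ n))
    (down -[1+ n ] (ℤ-induction P base up down -[1+ n ]))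

FibonacciLike : (ℤ → ℤ) → Set
FibonacciLike u = ∀ n → u (n + + 2) ≡ u (n + + 1) + u n

module _ {u : ℤ → ℤ} (rec : FibonacciLike u) where

  fibonacciLike-backward : ∀ n → u (n - + 1) ≡ u (n + + 1) - u n
  fibonacciLike-backward n = begin
    u (n - + 1)
      ≡⟨ cancel (u n) (u (n - + 1)) ⟩
    u n + u (n - + 1) - u n
      ≡⟨ cong (λ i → u i + u (n - + 1) - u n) (sym (i-1+1≡i n)) ⟩
    u (n - + 1 + + 1) + u (n - + 1) - u n
      ≡⟨ cong (_- u n) (sym (rec (n - + 1))) ⟩
    u (n - + 1 + + 2) - u n
      ≡⟨ cong (λ i → u i - u n) (i-1+2≡i+1 n) ⟩
    u (n + + 1) - u n
      ∎
    where
    cancel : ∀ a b → b ≡ a + b - a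
    cancel = solve-∀

  fibonacciLike-translate : ∀ s → FibonacciLike (λ n → u (n + s))
  fibonacciLike-translate s n = begin
    u (n + + 2 + s)               ≡⟨ cong u (xy∙z≈xz∙y n (+ 2) s) ⟩
    u (n + s + + 2)               ≡⟨ rec (n + s) ⟩
    u (n + s + + 1) + u (n + s)   ≡⟨ cong (λ i → u i + u (n + s)) (xy∙z≈xz∙y n s (+ 1)) ⟩
    u (n + + 1 + s) + u (n + s)   ∎

fibonacciLike-linear : ∀ {u v} → FibonacciLike u → FibonacciLike v →
                       ∀ a b → FibonacciLike (λ n → a * u n + b * v n)
fibonacciLike-linear {u} {v} recu recv a b n = begin
  a * u (n + + 2) + b * v (n + + 2)
    ≡⟨ cong₂ (λ x y → a * x + b * y) (recu n) (recv n) ⟩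
  a * (u (n + + 1) + u n) + b * (v (n + + 1) + v n)
    ≡⟨ distrib a b _ _ _ _ ⟩
  a * u (n + + 1) + b * v (n + + 1) + (a * u n + b * v n)
    ∎
  where
  distrib : ∀ a b x₁ x₀ y₁ y₀ →
    a * (x₁ + x₀) + b * (y₁ + y₀) ≡ a * x₁ + b * y₁ + (a * x₀ + b * y₀)
  distrib = solve-∀

fibonacciLike-unique : ∀ {u v} → FibonacciLike u → FibonacciLike v →
                       u (+ 0) ≡ v (+ 0) → u (+ 1) ≡ v (+ 1) → ∀ n → u n ≡ v n
fibonacciLike-unique {u} {v} recu recv e₀ e₁ n = proj₁ (ℤ-induction Agree (e₀ , e₁) up down n)
  where
  Agree : ℤ → Set
  Agree n = u n ≡ v n × u (n + + 1) ≡ v (n + + 1)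

  up : ∀ n → Agree n → Agree (n + + 1)
  up n (eₙ , eₙ₊₁) = eₙ₊₁ , (begin
    u (n + + 1 + + 1)   ≡⟨ cong u (i+1+1≡i+2 n) ⟩
    u (n + + 2)         ≡⟨ recu n ⟩
    u (n + + 1) + u n   ≡⟨ cong₂ _+_ eₙ₊₁ eₙ ⟩
    v (n + + 1) + v n   ≡⟨ sym (recv n) ⟩
    v (n + + 2)         ≡⟨ cong v (sym (i+1+1≡i+2 n)) ⟩
    v (n + + 1 + + 1)   ∎)

  down : ∀ n → Agree n → Agree (n - + 1)
  down n (eₙ , eₙ₊₁) = (begin
    u (n - + 1)         ≡⟨ fibonacciLike-backward {u} recu n ⟩
    u (n + + 1) - u n   ≡⟨ cong₂ _-_ eₙ₊₁ eₙ ⟩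
    v (n + + 1) - v n   ≡⟨ sym (fibonacciLike-backward {v} recv n) ⟩
    v (n - + 1)         ∎) , subst (λ i → u i ≡ v i) (sym (i-1+1≡i n)) eₙ

negSign-suc : ∀ n x → negSign (suc n) x ≡ - negSign n x
negSign-suc zero          x = refl
negSign-suc (suc zero)    x = sym (neg-involutive x)
negSign-suc (suc (suc n)) x = negSign-suc n x

negSign-+ : ∀ n x y → negSign n (x + y) ≡ negSign n x + negSign n y
negSign-+ zero          x y = refl
negSign-+ (suc zero)    x y = neg-distrib-+ x y
negSign-+ (suc (suc n)) x y = negSign-+ n x y

F-rec : FibonacciLike F
F-rec (+ n) rewrite ℕ.+-comm n 2 | ℕ.+-comm n 1 = refl
F-rec -[1+ zero ] = refl
F-rec -[1+ suc zero ] = refl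
-- Indices −(n+1), −(n+2), −(n+3): the sign of F alternates, and negSign (n + 2) = negSign n.
F-rec -[1+ suc (suc n) ] = begin
  negSign n f₁                                ≡⟨ cancel (negSign n f₂) (negSign n f₁) ⟩
  - negSign n f₂ + (negSign n f₂ + negSign n f₁)
    ≡⟨ sym (cong₂ _+_ (negSign-suc n f₂) (negSign-+ n f₂ f₁)) ⟩
  negSign (suc n) f₂ + negSign n (f₂ + f₁)    ∎
  where
  f₁ f₂ : ℤ
  f₁ = + fibℕ (suc n)
  f₂ = + fibℕ (suc (suc n))
  cancel : ∀ a b → b ≡ - a + (a + b)
  cancel = solve-∀

F-backward : ∀ n → F (n - + 1) ≡ F (n + + 1) - F n
F-backward = fibonacciLike-backward {F} F-rec

F-+ : ∀ p q → F (p + q) ≡ F (p + + 1) * F q + F p * F (q - + 1)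
F-+ p q = trans (cong F (+-comm p q)) (fibonacciLike-unique lhs-rec rhs-rec base₀ base₁ q)
  where
  lhs-rec : FibonacciLike (λ q → F (q + p))
  lhs-rec = fibonacciLike-translate {F} F-rec p
  rhs-rec : FibonacciLike (λ q → F (p + + 1) * F q + F p * F (q - + 1))
  rhs-rec = fibonacciLike-linear {F} F-rec (fibonacciLike-translate {F} F-rec (- + 1))
              (F (p + + 1)) (F p)
  base₀ : F (+ 0 + p) ≡ F (p + + 1) * + 0 + F p * + 1
  base₀ = trans (cong F (+-identityˡ p)) (ring (F (p + + 1)) (F p))
    where
    ring : ∀ a b → b ≡ a * + 0 + b * + 1
    ring = solve-∀
  base₁ : F (+ 1 + p) ≡ F (p + + 1) * + 1 + F p * + 0
  base₁ = trans (cong F (+-comm (+ 1) p)) (ring (F (p + + 1)) (F p))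
    where
    ring : ∀ a b → a ≡ a * + 1 + b * + 0
    ring = solve-∀

F-+-suc : ∀ p q → F (p + q + + 1) ≡ F (p + + 1) * F (q + + 1) + F p * F q
F-+-suc p q = begin
  F (p + q + + 1)
    ≡⟨ cong F (+-assoc p q (+ 1)) ⟩
  F (p + (q + + 1))
    ≡⟨ F-+ p (q + + 1) ⟩
  F (p + + 1) * F (q + + 1) + F p * F (q + + 1 - + 1)
    ≡⟨ cong (λ i → F (p + + 1) * F (q + + 1) + F p * F i) (i+1-1≡i q) ⟩
  F (p + + 1) * F (q + + 1) + F p * F q
    ∎

cassini : ℤ → ℤ
cassini n = F (n + + 1) * F (n - + 1) - F n * F n

cassini-suc : ∀ n → cassini (n + + 1) ≡ - cassini n
cassini-suc n = begin
  F (n + + 1 + + 1) * F (n + + 1 - + 1) - F (n + + 1) * F (n + + 1)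
    ≡⟨ cong₂ (λ i l → F i * F l - F (n + + 1) * F (n + + 1)) (i+1+1≡i+2 n) (i+1-1≡i n) ⟩
  F (n + + 2) * F n - F (n + + 1) * F (n + + 1)
    ≡⟨ ring (F (n - + 1)) (F n) (F (n + + 1)) (F (n + + 2)) (F-backward n) (F-rec n) ⟩
  - cassini n
    ∎
  where
  ring : ∀ a b c d → a ≡ c - b → d ≡ c + b → d * b - c * c ≡ - (c * a - b * b)
  ring _ b c _ refl refl = solve b c
    where
    solve : ∀ b c → (c + b) * b - c * c ≡ - (c * (c - b) - b * b)
    solve = solve-∀

cassini-+2 : ∀ n → cassini (n + + 1 + + 1) ≡ cassini n
cassini-+2 n = begin
  cassini (n + + 1 + + 1)   ≡⟨ cassini-suc (n + + 1) ⟩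
  - cassini (n + + 1)       ≡⟨ cong -_ (cassini-suc n) ⟩
  - - cassini n             ≡⟨ neg-involutive (cassini n) ⟩
  cassini n                 ∎

cassini-odd : ∀ j → cassini (+ 2 * j - + 1) ≡ - + 1
cassini-odd = ℤ-induction (λ j → cassini (+ 2 * j - + 1) ≡ - + 1) refl up down
  where
  up-index : ∀ j → + 2 * (j + + 1) - + 1 ≡ + 2 * j - + 1 + + 1 + + 1
  up-index = solve-∀
  down-index : ∀ j → + 2 * (j - + 1) - + 1 + + 1 + + 1 ≡ + 2 * j - + 1
  down-index = solve-∀
  up : ∀ j → cassini (+ 2 * j - + 1) ≡ - + 1 → cassini (+ 2 * (j + + 1) - + 1) ≡ - + 1
  up j h = trans (cong cassini (up-index j)) (trans (cassini-+2 (+ 2 * j - + 1)) h)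
  down : ∀ j → cassini (+ 2 * j - + 1) ≡ - + 1 → cassini (+ 2 * (j - + 1) - + 1) ≡ - + 1
  down j h = trans (sym (cassini-+2 (+ 2 * (j - + 1) - + 1))) (trans (cong cassini (down-index j)) h)

F-*-translate : ∀ x y c → F (x + c) * F (y + c) ≡
  F (x + y + + 1) * (F c * F c) + F (x + y) * (F c * F (c - + 1)) + cassini c * (F x * F y)
F-*-translate x y c = begin
  F (x + c) * F (y + c)
    ≡⟨ cong₂ _*_ (F-+ x c) (F-+ y c) ⟩
  (F (x + + 1) * F c + F x * F (c - + 1)) * (F (y + + 1) * F c + F y * F (c - + 1))
    ≡⟨ ring (F x) (F (x + + 1)) (F (y - + 1)) (F y) (F (y + + 1)) (F (c - + 1)) (F c) (F (c + + 1))
            (F-backward y) (F-backward c) ⟩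
  (F (x + + 1) * F (y + + 1) + F x * F y) * (F c * F c)
    + (F (x + + 1) * F y + F x * F (y - + 1)) * (F c * F (c - + 1)) + cassini c * (F x * F y)
    ≡⟨ sym (cong₂ (λ s t → s * (F c * F c) + t * (F c * F (c - + 1)) + cassini c * (F x * F y))
                  (F-+-suc x y) (F-+ x y)) ⟩
  F (x + y + + 1) * (F c * F c) + F (x + y) * (F c * F (c - + 1)) + cassini c * (F x * F y)
    ∎
  where
  ring : ∀ x₀ x₁ y₋ y₀ y₁ c₋ c₀ c₁ → y₋ ≡ y₁ - y₀ → c₋ ≡ c₁ - c₀ →
    (x₁ * c₀ + x₀ * c₋) * (y₁ * c₀ + y₀ * c₋) ≡
    (x₁ * y₁ + x₀ * y₀) * (c₀ * c₀) + (x₁ * y₀ + x₀ * y₋) * (c₀ * c₋) + (c₁ * c₋ - c₀ * c₀) * (x₀ * y₀)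
  ring x₀ x₁ _ y₀ y₁ _ c₀ c₁ refl refl = solve x₀ x₁ y₀ y₁ c₀ c₁
    where
    solve : ∀ x₀ x₁ y₀ y₁ c₀ c₁ →
      (x₁ * c₀ + x₀ * (c₁ - c₀)) * (y₁ * c₀ + y₀ * (c₁ - c₀)) ≡
      (x₁ * y₁ + x₀ * y₀) * (c₀ * c₀) + (x₁ * y₀ + x₀ * (y₁ - y₀)) * (c₀ * (c₁ - c₀))
        + (c₁ * (c₁ - c₀) - c₀ * c₀) * (x₀ * y₀)
    solve = solve-∀

F-*-translate-exchange : ∀ x y z w c → x + y ≡ z + w →
  F (x + c) * F (y + c) ≡ F (z + c) * F (w + c) + cassini c * (F x * F y - F z * F w)
F-*-translate-exchange x y z w c x+y≡z+w = begin
  F (x + c) * F (y + c)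
    ≡⟨ F-*-translate x y c ⟩
  common (x + y) + cassini c * (F x * F y)
    ≡⟨ cong (λ s → common s + cassini c * (F x * F y)) x+y≡z+w ⟩
  common (z + w) + cassini c * (F x * F y)
    ≡⟨ ring (common (z + w)) (cassini c) (F x * F y) (F z * F w) ⟩
  common (z + w) + cassini c * (F z * F w) + cassini c * (F x * F y - F z * F w)
    ≡⟨ cong (_+ cassini c * (F x * F y - F z * F w)) (sym (F-*-translate z w c)) ⟩
  F (z + c) * F (w + c) + cassini c * (F x * F y - F z * F w)
    ∎
  where
  common : ℤ → ℤ
  common s = F (s + + 1) * (F c * F c) + F s * (F c * F (c - + 1))
  ring : ∀ a k p q → a + k * p ≡ a + k * q + k * (p - q)
  ring = solve-∀

F-+-exchange : ∀ a b k →
  F (a + b) * F k ≡ F (k + b) * F a + F b * (F (a + + 1) * F k - F (k + + 1) * F a)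
F-+-exchange a b k = begin
  F (a + b) * F k
    ≡⟨ cong (_* F k) (F-+ a b) ⟩
  (F (a + + 1) * F b + F a * F (b - + 1)) * F k
    ≡⟨ ring (F a) (F (a + + 1)) (F b) (F (b - + 1)) (F k) (F (k + + 1)) ⟩
  (F (k + + 1) * F b + F k * F (b - + 1)) * F a + F b * (F (a + + 1) * F k - F (k + + 1) * F a)
    ≡⟨ cong (λ t → t * F a + F b * (F (a + + 1) * F k - F (k + + 1) * F a)) (sym (F-+ k b)) ⟩
  F (k + b) * F a + F b * (F (a + + 1) * F k - F (k + + 1) * F a)
    ∎
  where
  ring : ∀ a₀ a₁ b₀ b₋ k₀ k₁ →
    (a₁ * b₀ + a₀ * b₋) * k₀ ≡ (k₁ * b₀ + k₀ * b₋) * a₀ + b₀ * (a₁ * k₀ - k₁ * a₀)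
  ring = solve-∀

propositionA3′ : ∀ k b c → cassini c ≡ - + 1 →
  F (k + + 1) * (F b * F b) + F (k + b + c) * F (b + c)
    ≡ F (b + b + c) * F (k + c) + F k * F b * F (b + + 1)
propositionA3′ k b c cassini-c = begin
  F (k + + 1) * (F b * F b) + F (k + b + c) * F (b + c)
    ≡⟨ cong (λ t → F (k + + 1) * (F b * F b) + t)
            (F-*-translate-exchange (k + b) b (b + b) k c index) ⟩
  F (k + + 1) * (F b * F b) + (P + cassini c * (R - F (b + b) * F k))
    ≡⟨ cong₂ (λ γ t → F (k + + 1) * (F b * F b) + (P + γ * (R - t)))
             cassini-c (F-+-exchange b b k) ⟩
  F (k + + 1) * (F b * F b) + (P + - + 1 * (R - (R + F b * (F (b + + 1) * F k - F (k + + 1) * F b))))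
    ≡⟨ ring (F k) (F (k + + 1)) (F b) (F (b + + 1)) P R ⟩
  P + F k * F b * F (b + + 1)
    ∎
  where
  P R : ℤ
  P = F (b + b + c) * F (k + c)
  R = F (k + b) * F b
  index : k + b + b ≡ b + b + k
  index = trans (+-assoc k b b) (+-comm k (b + b))
  ring : ∀ k₀ k₁ b₀ b₁ p r →
    k₁ * (b₀ * b₀) + (p + - + 1 * (r - (r + b₀ * (b₁ * k₀ - k₁ * b₀)))) ≡ p + k₀ * b₀ * b₁
  ring = solve-∀

propositionA3 : ∀ (m j k : ℤ) →
    F (k + + 1) * (F (m - + 2 * j - k + + 2) * F (m - + 2 * j - k + + 2))
      + F (m + + 1) * F (m - k + + 1)
    ≡ F (+ 2 * m - + 2 * j - + 2 * k + + 3) * F (+ 2 * j + k - + 1)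
      + F k * F (m - + 2 * j - k + + 2) * F (m - + 2 * j - k + + 3)
propositionA3 m j k = begin
  F (k + + 1) * (F b * F b) + F (m + + 1) * F (m - k + + 1)
    ≡⟨ cong₂ (λ s t → F (k + + 1) * (F b * F b) + F s * F t) (index₁ m j k) (index₂ m j k) ⟩
  F (k + + 1) * (F b * F b) + F (k + b + c) * F (b + c)
    ≡⟨ propositionA3′ k b c (cassini-odd j) ⟩
  F (b + b + c) * F (k + c) + F k * F b * F (b + + 1)
    ≡⟨ cong₂ (λ s t → F s * F t + F k * F b * F (b + + 1)) (index₃ m j k) (index₄ m j k) ⟩
  F (+ 2 * m - + 2 * j - + 2 * k + + 3) * F (+ 2 * j + k - + 1) + F k * F b * F (b + + 1)
    ≡⟨ cong (λ s → F (+ 2 * m - + 2 * j - + 2 * k + + 3) * F (+ 2 * j + k - + 1) + F k * F b * F s)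
            (index₅ m j k) ⟩
  F (+ 2 * m - + 2 * j - + 2 * k + + 3) * F (+ 2 * j + k - + 1) + F k * F b * F (m - + 2 * j - k + + 3)
    ∎
  where
  b c : ℤ
  b = m - + 2 * j - k + + 2
  c = + 2 * j - + 1
  index₁ : ∀ m j k → m + + 1 ≡ k + (m - + 2 * j - k + + 2) + (+ 2 * j - + 1)
  index₁ = solve-∀
  index₂ : ∀ m j k → m - k + + 1 ≡ (m - + 2 * j - k + + 2) + (+ 2 * j - + 1)
  index₂ = solve-∀
  index₃ : ∀ m j k → (m - + 2 * j - k + + 2) + (m - + 2 * j - k + + 2) + (+ 2 * j - + 1)
                     ≡ + 2 * m - + 2 * j - + 2 * k + + 3
  index₃ = solve-∀
  index₄ : ∀ m j k → k + (+ 2 * j - + 1) ≡ + 2 * j + k - + 1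
  index₄ = solve-∀
  index₅ : ∀ m j k → (m - + 2 * j - k + + 2) + + 1 ≡ m - + 2 * j - k + + 3
  index₅ = solve-∀
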